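{- Let $f\in\{1,-1\}^{\mathbb{N}}$ be any folding instruction sequence and let $n\ge7$. Then the factor $u=P_f[6\phi(n):6\phi(n)+n-1]$ is the last length-$n$ factor to appear in $P_f$: if $m$ denotes the starting index of the first occurrence of $u$ in $P_f$, then every length-$n$ factor of $P_f$ has an occurrence in $P_f$ starting at some index $\le m$ (equivalently, $S_f(n)=m$).
   Context: A folding instruction sequence is an infinite sequence $f=(f_0,f_1,\dots)$ with each $f_i\in\{1,-1\}$. The paper-folding sequence $P_f=P_f[1],P_f[2],\dots$ is defined by: for $k\ge1$ write $k=2^s r$ with $r$ odd; $P_f[k]=f_s$ if $r\equiv 1\pmod 4$ and $P_f[k]=-f_s$ if $r\equiv3\pmod4$. $P_f[i:j]$ denotes $P_f[i]P_f[i+1]\cdots P_f[j]$. A length-$n$ factor of $P_f$ is a word equal to $P_f[i:i+n-1]$ for some $i\ge1$; it occurs starting at index $i$ if $P_f[i:i+n-1]$ equals it, and its first occurrence is the least such $i$. $S_f(n)$ is the least integer $k$ such that every length-$n$ factor of $P_f$ occurs starting at some index $i\le k$. $\phi(n)$ is the least power of $2$ that is $\ge n$. -}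

module Defs where

open import Data.Nat using (ℕ; zero; suc; _+_; _*_; _^_; _≤_; _<_; _≡ᵇ_)
open import Data.Nat.DivMod using (_/_; _%_)
open import Data.Bool using (if_then_else_)
open import Data.Product using (Σ; _×_; ∃)
open import Relation.Binary.PropositionalEquality using (_≡_)
open import Relation.Nullary using (¬_)

data Sign : Set where
  pos neg : Sign   -- pos = 1, neg = -1

negate : Sign → Sign
negate pos = neg
negate neg = pos

FoldSeq : Set
FoldSeq = ℕ → Sign

-- paperAux fuel f s k: with k = 2^t r (r odd), returns f_{s+t} if r ≡ 1 (mod 4)
-- and -f_{s+t} if r ≡ 3 (mod 4).  Fuel ≥ k suffices for k ≥ 1.
paperAux : ℕ → FoldSeq → ℕ → ℕ → Sign
paperAux zero     f s k = f s
paperAux (suc fu) f s k =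
  if k % 4 ≡ᵇ 1 then f s
  else if k % 4 ≡ᵇ 3 then negate (f s)
  else paperAux fu f (suc s) (k / 2)

-- The paper-folding sequence P_f[k] (meaningful for k ≥ 1).
P : FoldSeq → ℕ → Sign
P f k = paperAux k f 0 k

SameFactor : FoldSeq → ℕ → ℕ → ℕ → Set
SameFactor f n i j = ∀ t → t < n → P f (i + t) ≡ P f (j + t)

IsPhi : ℕ → ℕ → Set
IsPhi n p = (Σ ℕ λ e → p ≡ 2 ^ e) × n ≤ p × (∀ q e → q ≡ 2 ^ e → n ≤ q → p ≤ q)

-- Let p = φ(n) = 2^(e+1) and w = 2p.  Away from the indices ≡ 0, p (mod w)
-- the sequence P_f is w-periodic, so the length-n factor starting at r + Q w
-- (1 ≤ r ≤ w) is determined by r and by the one column, p + Q w or w + Q w,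
-- that its window may meet (it cannot meet both, as n ≤ p).  The p-column only
-- depends on Q mod 2, and the w-column P_f[(Q+1) w] takes just the two values
-- P_f[w] = f_(e+2) and P_f[3w] = -f_(e+2).  The factor u at 6p = 3w agrees with
-- P_f[1 .. n-1], which forces every occurrence m of u to be a multiple q w with
-- P_f[q w] = -f_(e+2), hence q ≥ 2.  So every factor already occurs with
-- column index 0, 1 or q - 1, that is, starting at an index ≤ m.
module Submission where

open import Defs
open import Data.Empty using (⊥-elim)
open import Data.Nat
open import Data.Nat.Properties
open import Data.Nat.DivMod using (m≡m%n+[m/n]*n; m%n<n; [m+kn]%n≡m%n; m*n/n≡m; m/n<m; m≥n⇒m/n>0)
open import Data.Nat.Divisibility using (_∣_; divides)
open import Data.Nat.Tactic.RingSolver using (solve-∀)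
open import Data.Bool using (true; false)
open import Data.Product using (Σ; ∃; _×_; _,_)
open import Data.Sum using (_⊎_; inj₁; inj₂)
open import Relation.Binary.PropositionalEquality
open import Relation.Nullary using (¬_; yes; no)
open import Algebra.Properties.CommutativeSemigroup +-commutativeSemigroup using (xy∙z≈xz∙y)

negate-≢ : ∀ s → negate s ≢ s
negate-≢ pos ()
negate-≢ neg ()

≡-or-≡negate : ∀ a b → a ≡ b ⊎ a ≡ negate b
≡-or-≡negate pos pos = inj₁ refl
≡-or-≡negate pos neg = inj₂ refl
≡-or-≡negate neg pos = inj₂ refl
≡-or-≡negate neg neg = inj₁ refl

even-or-odd : ∀ x → ∃ λ y → x ≡ y * 2 ⊎ x ≡ suc (y * 2)
even-or-odd zero = 0 , inj₁ refl
even-or-odd (suc zero) = 0 , inj₂ refl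
even-or-odd (suc (suc x)) with even-or-odd x
... | y , inj₁ refl = suc y , inj₁ refl
... | y , inj₂ refl = suc y , inj₂ refl

even-mod4 : ∀ y → (y * 2) % 4 ≡ 0 ⊎ (y * 2) % 4 ≡ 2
even-mod4 zero = inj₁ refl
even-mod4 (suc zero) = inj₂ refl
even-mod4 (suc (suc y)) = even-mod4 y

shift : FoldSeq → FoldSeq
shift f i = f (suc i)

shiftN : ℕ → FoldSeq → FoldSeq
shiftN zero    f = f
shiftN (suc s) f = shift (shiftN s f)

paperAux-shift : ∀ fu g s k → paperAux fu g (suc s) k ≡ paperAux fu (shift g) s k
paperAux-shift zero g s k = refl
paperAux-shift (suc fu) g s k with k % 4 ≡ᵇ 1 | k % 4 ≡ᵇ 3
... | true  | _     = refl
... | false | true  = refl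
... | false | false = paperAux-shift fu g (suc s) (k / 2)

paperAux-fuel : ∀ fu fu' g s k → 1 ≤ k → k ≤ fu → k ≤ fu' → paperAux fu g s k ≡ paperAux fu' g s k
paperAux-fuel (suc fu) (suc fu') g s (suc zero) _ _ _ = refl
paperAux-fuel (suc fu) (suc fu') g s k@(suc (suc _)) _ (s≤s k≤1+fu) (s≤s k≤1+fu')
  with k % 4 ≡ᵇ 1 | k % 4 ≡ᵇ 3
... | true  | _     = refl
... | false | true  = refl
... | false | false =
  paperAux-fuel fu fu' g (suc s) (k / 2) (m≥n⇒m/n>0 {k} {2} (s≤s (s≤s z≤n)))
    (≤-trans k/2≤ k≤1+fu) (≤-trans k/2≤ k≤1+fu')
  where
  k/2≤ : k / 2 ≤ pred k
  k/2≤ = ≤-pred (m/n<m k 2 (s≤s (s≤s z≤n)))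

paperAux-even : ∀ fu g s y → paperAux (suc fu) g s (y * 2) ≡ paperAux fu g (suc s) y
paperAux-even fu g s y with even-mod4 y
... | inj₁ y*2%4≡0 rewrite y*2%4≡0 = cong (paperAux fu g (suc s)) (m*n/n≡m y 2)
... | inj₂ y*2%4≡2 rewrite y*2%4≡2 = cong (paperAux fu g (suc s)) (m*n/n≡m y 2)

P-1mod4 : ∀ g q → P g (suc (q * 4)) ≡ g 0
P-1mod4 g q rewrite [m+kn]%n≡m%n 1 q 4 {{_}} = refl

P-3mod4 : ∀ g q → P g (3 + q * 4) ≡ negate (g 0)
P-3mod4 g q rewrite [m+kn]%n≡m%n 3 q 4 {{_}} = refl

P-double : ∀ g y → P g (suc y * 2) ≡ P (shift g) (suc y)
P-double g y = begin
  P g (suc y * 2)                             ≡⟨ paperAux-even (suc (y * 2)) g 0 (suc y) ⟩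
  paperAux (suc (y * 2)) g 1 (suc y)          ≡⟨ paperAux-shift (suc (y * 2)) g 0 (suc y) ⟩
  paperAux (suc (y * 2)) (shift g) 0 (suc y)  ≡⟨ paperAux-fuel (suc (y * 2)) (suc y) (shift g) 0 (suc y)
                                                   (s≤s z≤n) (s≤s (m≤m*n y 2)) ≤-refl ⟩
  P (shift g) (suc y)                         ∎
  where open ≡-Reasoning

P-*2^ : ∀ s f x → P f (suc x * 2 ^ s) ≡ P (shiftN s f) (suc x)
P-*2^ zero    f x = cong (P f) (*-identityʳ (suc x))
P-*2^ (suc s) f x = begin
  P f (suc x * (2 * 2 ^ s))     ≡⟨ cong (P f) (sym (*-assoc (suc x) 2 (2 ^ s))) ⟩
  P f (suc x * 2 * 2 ^ s)       ≡⟨ P-*2^ s f (suc (x * 2)) ⟩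
  P (shiftN s f) (suc x * 2)    ≡⟨ P-double (shiftN s f) x ⟩
  P (shiftN (suc s) f) (suc x)  ∎
  where open ≡-Reasoning

P-odd-periodic : ∀ g y c → P g (suc (y * 2) + c * 4) ≡ P g (suc (y * 2))
P-odd-periodic g y c with even-or-odd y
... | z , inj₁ refl rewrite *-assoc z 2 2 | sym (*-distribʳ-+ 4 z c) =
  trans (P-1mod4 g (z + c)) (sym (P-1mod4 g z))
... | z , inj₂ refl rewrite *-assoc z 2 2 | sym (*-distribʳ-+ 4 z c) =
  trans (P-3mod4 g (z + c)) (sym (P-3mod4 g z))

P-periodic : ∀ e f a c → 1 ≤ a → a < 2 ^ suc e → a ≢ 2 ^ e → P f (a + c * 2 ^ suc e) ≡ P f a
P-periodic zero f (suc zero) c _ _ a≢1 = ⊥-elim (a≢1 refl)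
P-periodic zero f (suc (suc a)) c _ (s≤s (s≤s ())) _
P-periodic (suc e) f a c 1≤a a<2^[2+e] a≢2^[1+e] with even-or-odd a
... | y , inj₂ refl =
  trans (cong (λ x → P f (suc (y * 2) + x)) (in-fours c (2 ^ e))) (P-odd-periodic f y (c * 2 ^ e))
  where
  in-fours : ∀ c h → c * (2 * (2 * h)) ≡ c * h * 4
  in-fours = solve-∀
... | zero , inj₁ refl = ⊥-elim (n≮0 1≤a)
... | suc y , inj₁ refl = begin
  P f (suc y * 2 + c * 2 ^ suc (suc e))  ≡⟨ cong (P f) (halve y c (2 ^ e)) ⟩
  P f (suc (y + c * 2 ^ suc e) * 2)      ≡⟨ P-double f (y + c * 2 ^ suc e) ⟩
  P (shift f) (suc y + c * 2 ^ suc e)    ≡⟨ P-periodic e (shift f) (suc y) c (s≤s z≤n) 1+y<2^[1+e] 1+y≢2^e ⟩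
  P (shift f) (suc y)                    ≡⟨ sym (P-double f y) ⟩
  P f (suc y * 2)                        ∎
  where
  open ≡-Reasoning
  halve : ∀ y c h → suc y * 2 + c * (2 * (2 * h)) ≡ suc (y + c * (2 * h)) * 2
  halve = solve-∀
  1+y<2^[1+e] : suc y < 2 ^ suc e
  1+y<2^[1+e] = *-cancelʳ-< 2 (suc y) (2 ^ suc e) (subst (suc y * 2 <_) (*-comm 2 (2 ^ suc e)) a<2^[2+e])
  1+y≢2^e : suc y ≢ 2 ^ e
  1+y≢2^e 1+y≡2^e = a≢2^[1+e] (trans (cong (_* 2) 1+y≡2^e) (*-comm (2 ^ e) 2))

shift-agreement⇒2∣ : ∀ g j → P g (j + 2) ≡ P g 2 → P g (j + 6) ≡ P g 6 → 2 ∣ j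
shift-agreement⇒2∣ g j at2 at6 with even-or-odd j
... | y , inj₁ refl = divides y refl
... | y , inj₂ refl = ⊥-elim (negate-≢ (P g 2) (begin
  P g 6                          ≡⟨ sym at6 ⟩
  P g (suc (y * 2) + 6)          ≡⟨ cong (P g) (odd+6 y) ⟩
  P g (suc (suc y * 2) + 1 * 4)  ≡⟨ P-odd-periodic g (suc y) 1 ⟩
  P g (suc (suc y * 2))          ≡⟨ cong (P g) (odd+2 y) ⟩
  P g (suc (y * 2) + 2)          ≡⟨ at2 ⟩
  P g 2                          ∎))
  where
  open ≡-Reasoning
  odd+6 : ∀ y → suc (y * 2) + 6 ≡ suc (suc y * 2) + 1 * 4
  odd+6 = solve-∀
  odd+2 : ∀ y → suc (suc y * 2) ≡ suc (y * 2) + 2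
  odd+2 = solve-∀

double-shift-agreement⇒2^∣ : ∀ k g j → (∀ t → 1 ≤ t → t ≤ 2 ^ k → P g (j * 2 + t) ≡ P g t) →
                              2 ^ suc k ∣ j
double-shift-agreement⇒2^∣ k g j agree with even-or-odd j
... | z , inj₂ refl = ⊥-elim (negate-≢ (g 0) (begin
  negate (g 0)               ≡⟨ sym (P-3mod4 g z) ⟩
  P g (3 + z * 4)            ≡⟨ cong (P g) (odd*2+1 z) ⟩
  P g (suc (z * 2) * 2 + 1)  ≡⟨ agree 1 ≤-refl (m^n>0 2 k) ⟩
  g 0                        ∎))
  where
  open ≡-Reasoning
  odd*2+1 : ∀ z → 3 + z * 4 ≡ suc (z * 2) * 2 + 1
  odd*2+1 = solve-∀
double-shift-agreement⇒2^∣ zero    g j agree | z , inj₁ refl = divides z refl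
double-shift-agreement⇒2^∣ (suc k) g j agree | z , inj₁ refl
  with double-shift-agreement⇒2^∣ k (shift g) z halved
  where
  halved : ∀ t → 1 ≤ t → t ≤ 2 ^ k → P (shift g) (z * 2 + t) ≡ P (shift g) t
  halved (suc t) _ 1+t≤2^k = begin
    P (shift g) (z * 2 + suc t)    ≡⟨ cong (P (shift g)) (+-suc (z * 2) t) ⟩
    P (shift g) (suc (z * 2 + t))  ≡⟨ sym (P-double g (z * 2 + t)) ⟩
    P g (suc (z * 2 + t) * 2)      ≡⟨ cong (P g) (distrib z t) ⟩
    P g (z * 2 * 2 + suc t * 2)    ≡⟨ agree (suc t * 2) (s≤s z≤n) (subst (suc t * 2 ≤_) (*-comm (2 ^ k) 2) (*-monoˡ-≤ 2 1+t≤2^k)) ⟩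
    P g (suc t * 2)                ≡⟨ P-double g t ⟩
    P (shift g) (suc t)            ∎
    where
    open ≡-Reasoning
    distrib : ∀ z t → suc (z * 2 + t) * 2 ≡ z * 2 * 2 + suc t * 2
    distrib = solve-∀
... | divides q refl = divides q (reassoc q (2 ^ k))
  where
  reassoc : ∀ q h → q * (2 * h) * 2 ≡ q * (2 * (2 * h))
  reassoc = solve-∀

shift-agreement⇒2^∣ : ∀ g n e j → 7 ≤ n → 2 ^ e < n →
                      (∀ t → 1 ≤ t → t < n → P g (j + t) ≡ P g t) → 2 ^ suc (suc e) ∣ j
shift-agreement⇒2^∣ g n e j 7≤n 2^e<n agree
  with shift-agreement⇒2∣ g j (agree 2 (s≤s z≤n) (≤-trans (s≤s (s≤s (s≤s z≤n))) 7≤n)) (agree 6 (s≤s z≤n) 7≤n)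
... | divides z refl
  with double-shift-agreement⇒2^∣ e g z (λ t 1≤t t≤2^e → agree t 1≤t (≤-<-trans t≤2^e 2^e<n))
...   | divides q refl = divides q (reassoc q (2 ^ e))
  where
  reassoc : ∀ q h → q * (2 * h) * 2 ≡ q * (2 * (2 * h))
  reassoc = solve-∀

IsPhi⇒2^[1+e] : ∀ {n p} → 2 ≤ n → IsPhi n p → ∃ λ e → p ≡ 2 ^ suc e × 2 ^ e < n
IsPhi⇒2^[1+e] 2≤n ((zero , refl) , n≤1 , _) = ⊥-elim (<⇒≱ 2≤n n≤1)
IsPhi⇒2^[1+e] {n} 2≤n ((suc e , refl) , _ , least) = e , refl , 2^e<n
  where
  2^e<n : 2 ^ e < n
  2^e<n with 2 ^ e <? n
  ... | yes 2^e<n = 2^e<n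
  ... | no 2^e≮n = ⊥-elim (<⇒≱ (^-monoʳ-< 2 (s≤s (s≤s z≤n)) (n<1+n e)) (least (2 ^ e) e refl (≮⇒≥ 2^e≮n)))

module FactorsOfLength (f : FoldSeq) (n e : ℕ) (7≤n : 7 ≤ n) (n≤p : n ≤ 2 ^ suc e) (2^e<n : 2 ^ e < n) where

  p w : ℕ
  p = 2 ^ suc e
  w = 2 ^ suc (suc e)

  G H : FoldSeq
  G = shiftN (suc (suc e)) f
  H = shiftN (suc e) f

  instance
    w≢0 : NonZero w
    w≢0 = m^n≢0 2 (suc (suc e))

  w≡p+p : w ≡ p + p
  w≡p+p = cong (p +_) (+-identityʳ p)

  p<w : p < w
  p<w = ^-monoʳ-< 2 (s≤s (s≤s z≤n)) (n<1+n (suc e))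

  P[6p+t]≡P[t] : ∀ t → 1 ≤ t → t < n → P f (6 * p + t) ≡ P f t
  P[6p+t]≡P[t] t 1≤t t<n =
    trans (cong (P f) (6p+t≡t+3w (2 ^ e) t))
          (P-periodic (suc e) f t 3 1≤t (<-trans t<p p<w) (<⇒≢ t<p))
    where
    t<p : t < p
    t<p = <-≤-trans t<n n≤p
    6p+t≡t+3w : ∀ h t → 6 * (2 * h) + t ≡ t + 3 * (2 * (2 * h))
    6p+t≡t+3w = solve-∀

  value-at-occurrence-of-u : ∀ q → SameFactor f n (suc q * w) (6 * p) → P G (suc q) ≡ negate (G 0)
  value-at-occurrence-of-u q same = begin
    P G (suc q)          ≡⟨ sym (P-*2^ (suc (suc e)) f q) ⟩
    P f (suc q * w)      ≡⟨ cong (P f) (sym (+-identityʳ (suc q * w))) ⟩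
    P f (suc q * w + 0)  ≡⟨ same 0 (≤-trans (s≤s z≤n) 7≤n) ⟩
    P f (6 * p + 0)      ≡⟨ cong (P f) (6p+0≡3w (2 ^ e)) ⟩
    P f (3 * w)          ≡⟨ P-*2^ (suc (suc e)) f 2 ⟩
    P G 3                ∎
    where
    open ≡-Reasoning
    6p+0≡3w : ∀ h → 6 * (2 * h) + 0 ≡ 3 * (2 * (2 * h))
    6p+0≡3w = solve-∀

  occurrence-of-u : ∀ m → 1 ≤ m → SameFactor f n m (6 * p) →
                    ∃ λ q → m ≡ suc (suc q) * w × P G (suc (suc q)) ≡ negate (G 0)
  occurrence-of-u m 1≤m same
    with shift-agreement⇒2^∣ f n e m 7≤n 2^e<n (λ t 1≤t t<n → trans (same t t<n) (P[6p+t]≡P[t] t 1≤t t<n))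
  ... | divides zero refl = ⊥-elim (n≮0 1≤m)
  ... | divides (suc zero) refl = ⊥-elim (negate-≢ (G 0) (sym (value-at-occurrence-of-u 0 same)))
  ... | divides (suc (suc q)) refl = q , refl , value-at-occurrence-of-u (suc q) same

  p-column-parity : ∀ Q → P f (p + Q * w) ≡ P f (p + Q % 2 * w)
  p-column-parity Q = begin
    P f (p + Q * w)                      ≡⟨ cong (P f) (p+Qw≡[1+2Q]p Q (2 ^ e)) ⟩
    P f (suc (Q * 2) * p)                ≡⟨ P-*2^ (suc e) f (Q * 2) ⟩
    P H (suc (Q * 2))                    ≡⟨ cong (λ x → P H (suc (x * 2))) (m≡m%n+[m/n]*n Q 2) ⟩
    P H (suc ((Q % 2 + Q / 2 * 2) * 2))  ≡⟨ cong (P H) (split-off-fours (Q % 2) (Q / 2)) ⟩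
    P H (suc (Q % 2 * 2) + Q / 2 * 4)    ≡⟨ P-odd-periodic H (Q % 2) (Q / 2) ⟩
    P H (suc (Q % 2 * 2))                ≡⟨ sym (P-*2^ (suc e) f (Q % 2 * 2)) ⟩
    P f (suc (Q % 2 * 2) * p)            ≡⟨ cong (P f) (sym (p+Qw≡[1+2Q]p (Q % 2) (2 ^ e))) ⟩
    P f (p + Q % 2 * w)                  ∎
    where
    open ≡-Reasoning
    p+Qw≡[1+2Q]p : ∀ Q h → 2 * h + Q * (2 * (2 * h)) ≡ suc (Q * 2) * (2 * h)
    p+Qw≡[1+2Q]p = solve-∀
    split-off-fours : ∀ a b → suc ((a + b * 2) * 2) ≡ suc (a * 2) + b * 4
    split-off-fours = solve-∀

  off-columns : ∀ a x y → 1 ≤ a → a < w + p → a ≢ p → a ≢ w → P f (a + x * w) ≡ P f (a + y * w)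
  off-columns a x y 1≤a a<w+p a≢p a≢w with a <? w
  ... | yes a<w = trans (P-periodic (suc e) f a x 1≤a a<w a≢p) (sym (P-periodic (suc e) f a y 1≤a a<w a≢p))
  ... | no a≮w with m≤n⇒∃[o]m+o≡n (≮⇒≥ a≮w)
  ...   | zero , refl = ⊥-elim (a≢w (+-identityʳ w))
  ...   | suc b , refl = trans (reduce x) (sym (reduce y))
    where
    b<p : suc b < p
    b<p = +-cancelˡ-< w (suc b) p a<w+p
    reduce : ∀ x → P f (w + suc b + x * w) ≡ P f (suc b)
    reduce x = trans (cong (P f) (carry w (suc b) x))
                     (P-periodic (suc e) f (suc b) (suc x) (s≤s z≤n) (<-trans b<p p<w) (<⇒≢ b<p))
      where
      carry : ∀ w b x → w + b + x * w ≡ b + suc x * w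
      carry = solve-∀

  same-window : ∀ r c Q → 1 ≤ r → r ≤ w →
                (r ≤ p → p < r + n → P f (p + c * w) ≡ P f (p + Q * w)) →
                (w < r + n → P f (w + c * w) ≡ P f (w + Q * w)) →
                SameFactor f n (r + c * w) (r + Q * w)
  same-window r c Q 1≤r r≤w at-p at-w t t<n = begin
    P f (r + c * w + t)  ≡⟨ cong (P f) (xy∙z≈xz∙y r (c * w) t) ⟩
    P f (r + t + c * w)  ≡⟨ column ⟩
    P f (r + t + Q * w)  ≡⟨ cong (P f) (xy∙z≈xz∙y r t (Q * w)) ⟩
    P f (r + Q * w + t)  ∎
    where
    open ≡-Reasoning
    r+t<r+n : r + t < r + n
    r+t<r+n = +-monoʳ-< r t<n
    column : P f (r + t + c * w) ≡ P f (r + t + Q * w)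
    column with r + t ≟ p | r + t ≟ w
    ... | yes r+t≡p | _ rewrite r+t≡p =
      at-p (subst (r ≤_) r+t≡p (m≤m+n r t)) (subst (_< r + n) r+t≡p r+t<r+n)
    ... | no _ | yes r+t≡w rewrite r+t≡w = at-w (subst (_< r + n) r+t≡w r+t<r+n)
    ... | no r+t≢p | no r+t≢w =
      off-columns (r + t) c Q (≤-trans 1≤r (m≤m+n r t)) (+-mono-≤-< r≤w (<-≤-trans t<n n≤p)) r+t≢p r+t≢w

  w<r+n⇒p<r : ∀ r → w < r + n → p < r
  w<r+n⇒p<r r w<r+n = +-cancelʳ-< p p r (subst (_< r + p) w≡p+p (<-≤-trans w<r+n (+-monoʳ-≤ r n≤p)))

  r+cw≤[2+q]w : ∀ r c q → r ≤ w → c ≤ suc q → r + c * w ≤ suc (suc q) * w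
  r+cw≤[2+q]w r c q r≤w c≤1+q = ≤-trans (+-monoˡ-≤ (c * w) r≤w) (*-monoˡ-≤ w (s≤s c≤1+q))

  early-copy : ∀ q → P G (suc (suc q)) ≡ negate (G 0) → ∀ r Q → 1 ≤ r → r ≤ w →
               Σ ℕ λ c → r + c * w ≤ suc (suc q) * w × SameFactor f n (r + c * w) (r + Q * w)
  early-copy q last r Q 1≤r r≤w with w <? r + n
  ... | no w≮r+n =
    Q % 2 , r+cw≤[2+q]w r (Q % 2) q r≤w (≤-trans (≤-pred (m%n<n Q 2)) (s≤s z≤n)) ,
    same-window r (Q % 2) Q 1≤r r≤w (λ _ _ → sym (p-column-parity Q)) (λ w<r+n → ⊥-elim (w≮r+n w<r+n))
  ... | yes w<r+n with ≡-or-≡negate (P G (suc Q)) (G 0)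
  ...   | inj₁ G₀ =
    0 , r+cw≤[2+q]w r 0 q r≤w z≤n ,
    same-window r 0 Q 1≤r r≤w (λ r≤p _ → ⊥-elim (<⇒≱ (w<r+n⇒p<r r w<r+n) r≤p))
      (λ _ → trans (P-*2^ (suc (suc e)) f 0) (trans (sym G₀) (sym (P-*2^ (suc (suc e)) f Q))))
  ...   | inj₂ -G₀ =
    suc q , r+cw≤[2+q]w r (suc q) q r≤w ≤-refl ,
    same-window r (suc q) Q 1≤r r≤w (λ r≤p _ → ⊥-elim (<⇒≱ (w<r+n⇒p<r r w<r+n) r≤p))
      (λ _ → trans (P-*2^ (suc (suc e)) f (suc q)) (trans last (trans (sym -G₀) (sym (P-*2^ (suc (suc e)) f Q)))))

  factors-occur-by-u : ∀ m → 1 ≤ m → SameFactor f n m (6 * p) →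
                       ∀ i → 1 ≤ i → Σ ℕ λ j → 1 ≤ j × j ≤ m × SameFactor f n j i
  factors-occur-by-u m 1≤m same (suc i) _ with occurrence-of-u m 1≤m same
  ... | q , refl , last with early-copy q last (suc (i % w)) (i / w) (s≤s z≤n) (m%n<n i w)
  ...   | c , j≤m , same-as-i =
    suc (i % w) + c * w , s≤s z≤n , j≤m ,
    subst (SameFactor f n (suc (i % w) + c * w)) (sym (cong suc (m≡m%n+[m/n]*n i w))) same-as-i

lemma3p2 : (f : FoldSeq) (n : ℕ) → 7 ≤ n → (p : ℕ) → IsPhi n p →
           (m : ℕ) → 1 ≤ m → SameFactor f n m (6 * p) →
           (∀ j → 1 ≤ j → j < m → ¬ SameFactor f n j (6 * p)) →
           ∀ i → 1 ≤ i → Σ ℕ λ j → 1 ≤ j × j ≤ m × SameFactor f n j i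
lemma3p2 f n 7≤n p phi@(_ , n≤p , _) m 1≤m same _
  with IsPhi⇒2^[1+e] (≤-trans (s≤s (s≤s z≤n)) 7≤n) phi
... | e , refl , 2^e<n = FactorsOfLength.factors-occur-by-u f n e 7≤n n≤p 2^e<n m 1≤m same
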